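{- Let $G$ be a graph with vertex set $\{v_i: i=0,1,2,\dots,n\}$. If for each $i\in[n]$ the set $N(v_i)\cap\{v_j:0\le j\le i-1\}$ is nonempty and the subgraph of $G$ induced by this vertex set is connected, then $G$ is DP-good.
   Context: All graphs are finite and simple; $N(v)$ denotes the set of neighbours of $v$ in $G$, and $[n]=\{1,\dots,n\}$. For an edge $e$ of $G$, let $\mathcal{C}_G(e)$ be the set of cycles of $G$ containing $e$ of minimum length, and let the girth $\ell_G(e)$ of $e$ be the length of the cycles in $\mathcal{C}_G(e)$ if this set is nonempty, and $\ell_G(e)=\infty$ otherwise. A graph $G$ is DP-good if $G$ has a spanning tree $T$ and a labeling $e_1,\dots,e_q$ of the edges of $E(G)\setminus E(T)$ (where $q=|E(G)|-|E(T)|$) such that $\ell_G(e_1)\le\cdots\le\ell_G(e_q)$ and for each $i\in[q]$, $\ell_G(e_i)$ is odd and there is some $C_i\in\mathcal{C}_G(e_i)$ with $E(C_i)\subseteq E(T)\cup\{e_1,\dots,e_i\}$. -}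

module Defs where

open import Data.Nat as ℕ using (ℕ; zero; suc; _+_; _*_)
open import Data.Fin using (Fin; zero; suc; toℕ; fromℕ<; _<_; _≤_)
open import Data.Bool using (Bool; T)
open import Data.Product using (Σ; ∃; _×_; _,_; proj₁; proj₂)
open import Data.Sum using (_⊎_)
open import Relation.Nullary using (¬_; yes; no)
open import Relation.Binary.PropositionalEquality using (_≡_)
open import Function.Definitions using (Injective)

-- A finite simple graph on the vertex set Fin N (vertex v_i is i).
record Graph (N : ℕ) : Set where
  field
    adj   : Fin N → Fin N → Bool
    sym   : ∀ u v → T (adj u v) → T (adj v u)
    irrefl : ∀ v → ¬ T (adj v v)

  Adj : Fin N → Fin N → Set
  Adj u v = T (adj u v)

open Graph public

csuc : ∀ {k} → Fin (suc k) → Fin (suc k)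
csuc {k} i with suc (toℕ i) ℕ.<? suc k
... | yes p = fromℕ< p
... | no _  = zero

record Cycle {N : ℕ} (R : Fin N → Fin N → Set) : Set where
  field
    m    : ℕ
    vs   : Fin (3 + m) → Fin N
    inj  : Injective _≡_ _≡_ vs
    adjs : ∀ i → R (vs i) (vs (csuc i))

  len : ℕ
  len = 3 + m

  HasEdge : Fin N → Fin N → Set
  HasEdge a b = ∃ λ i → (vs i ≡ a × vs (csuc i) ≡ b) ⊎ (vs i ≡ b × vs (csuc i) ≡ a)

open Cycle public

data Walk {N : ℕ} (R : Fin N → Fin N → Set) : Fin N → Fin N → Set where
  here : ∀ {u} → Walk R u u
  step : ∀ {u v w} → R u v → Walk R v w → Walk R u w

-- ℓ_G(e) = k for the edge e = {a,b}: k is the minimum length of a cycle of G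
-- containing e (so in particular such a cycle exists, i.e. ℓ_G(e) < ∞).
GirthIs : ∀ {N} → Graph N → Fin N → Fin N → ℕ → Set
GirthIs G a b k =
  (Σ (Cycle (Adj G)) λ C → len C ≡ k × HasEdge C a b)
  × (∀ (C : Cycle (Adj G)) → HasEdge C a b → k ℕ.≤ len C)

Odd : ℕ → Set
Odd k = ∃ λ j → k ≡ 1 + 2 * j

record SpanningTree {N : ℕ} (G : Graph N) : Set where
  field
    tadj   : Fin N → Fin N → Bool
    tsym   : ∀ u v → T (tadj u v) → T (tadj v u)
    sub    : ∀ u v → T (tadj u v) → Adj G u v
    conn   : ∀ u v → Walk (λ x y → T (tadj x y)) u v
    acyc   : ¬ Cycle (λ x y → T (tadj x y))

  TAdj : Fin N → Fin N → Set
  TAdj u v = T (tadj u v)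

open SpanningTree public

-- DP-good. The non-tree edges are labelled e₁,…,e_q by e : Fin q → V × V,
-- each edge {u,v} written once as (u , v) with u < v.
DPGood : ∀ {N} → Graph N → Set
DPGood {N} G =
  Σ (SpanningTree G) λ Tr →
  Σ ℕ λ q →
  Σ (Fin q → Fin N × Fin N) λ e →
  Σ (Fin q → ℕ) λ ℓ →
    -- e enumerates E(G) ∖ E(T) bijectively
    (∀ i → proj₁ (e i) < proj₂ (e i))
    × (∀ i → Adj G (proj₁ (e i)) (proj₂ (e i)))
    × (∀ i → ¬ TAdj Tr (proj₁ (e i)) (proj₂ (e i)))
    × Injective _≡_ _≡_ e
    × (∀ u v → u < v → Adj G u v → ¬ TAdj Tr u v → ∃ λ i → e i ≡ (u , v))
    × (∀ i → GirthIs G (proj₁ (e i)) (proj₂ (e i)) (ℓ i))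
    × (∀ i j → i ≤ j → ℓ i ℕ.≤ ℓ j)
    × (∀ i → Odd (ℓ i))
    -- some C_i ∈ 𝒞_G(e_i) with E(C_i) ⊆ E(T) ∪ {e_1,…,e_i}
    × (∀ i → Σ (Cycle (Adj G)) λ C →
         len C ≡ ℓ i × HasEdge C (proj₁ (e i)) (proj₂ (e i))
         × (∀ x y → HasEdge C x y →
              TAdj Tr x y ⊎ (∃ λ j → j ≤ i × (e j ≡ (x , y) ⊎ e j ≡ (y , x)))))

InPrev : ∀ {N} → Graph N → Fin N → Fin N → Set
InPrev G i j = j < i × Adj G i j

-- Hypothesis of Corollary 1.1, for G on {v_0,…,v_n} = Fin (suc n).
GoodOrder : ∀ {n} → Graph (suc n) → Set
GoodOrder {n} G = ∀ (i : Fin n) →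
  (∃ λ j → InPrev G (suc i) j)
  × (∀ a b → InPrev G (suc i) a → InPrev G (suc i) b →
       Walk (λ x y → Adj G x y × InPrev G (suc i) x × InPrev G (suc i) y) a b)

{-# OPTIONS --safe #-}
module Submission where

-- Joining each vertex v_i (i ≥ 1) to one earlier neighbour, its parent, gives a spanning tree.
-- Every non-tree edge lies in a triangle, so its girth is 3. List the non-tree edges greedily,
-- each closing a triangle with tree edges and edges listed before it, until none can be added;
-- connectivity of G[N(v_i) ∩ {v_j : j < i}] shows that no non-tree edge v_u v_i is left over.

open import Data.Nat using (ℕ; suc)
open import Defs

open import Data.Nat as ℕ using (zero; _+_; _*_)
import Data.Nat.Properties as ℕ
open import Data.Fin as Fin using (Fin; zero; suc; toℕ; fromℕ; inject₁; punchIn; _≟_; _<_; _≤_)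
import Data.Fin.Properties as Fin
open import Data.Fin.Induction using (<-wellFounded)
open import Data.Bool using (Bool; false; T; _∨_)
open import Data.Bool.Properties using (T-∨)
open import Data.Product using (Σ; ∃; ∃₂; _×_; _,_; proj₁; proj₂; map₂)
open import Data.Product.Properties using (≡-dec; ×-≡,≡→≡)
open import Data.Sum using (_⊎_; inj₁; inj₂)
import Data.Sum as Sum
open import Data.Vec.Functional using (Vector; insertAt)
open import Data.Vec.Functional.Properties using (insertAt-lookup; insertAt-punchIn)
open import Data.Empty using (⊥-elim)
open import Function using (_∘_; Equivalence)
open import Function.Definitions using (Injective)
open import Induction.WellFounded as WF using (WfRec)
open import Relation.Binary.Definitions using (tri<; tri≈; tri>)
import Relation.Binary.PropositionalEquality as ≡
open ≡ using (_≡_; _≢_; refl; trans; cong; subst; subst₂)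
open import Relation.Nullary using (¬_; Dec; yes; no)
open import Relation.Nullary.Decidable using (⌊_⌋; T?; toWitness; fromWitness; _×-dec_; _⊎-dec_; ¬?)
open import Relation.Unary using (Decidable)

data CyclicStep (k : ℕ) : ℕ → ℕ → Set where
  forward : ∀ {a} → CyclicStep k a (suc a)
  wrap    : CyclicStep k k 0

csuc-step : ∀ {k} (i : Fin (suc k)) → CyclicStep k (toℕ i) (toℕ (csuc i))
csuc-step {k} i with suc (toℕ i) ℕ.<? suc k
... | yes i<k = subst (CyclicStep k (toℕ i)) (≡.sym (Fin.toℕ-fromℕ< i<k)) forward
... | no  i≮k = subst (λ a → CyclicStep k a 0)
                      (ℕ.≤-antisym (ℕ.s≤s⁻¹ (ℕ.≮⇒≥ i≮k)) (ℕ.s≤s⁻¹ (Fin.toℕ<n i))) wrap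

cyclicStep-irrefl : ∀ {k a} → ¬ CyclicStep (2 + k) a a
cyclicStep-irrefl ()

cyclicStep-asym : ∀ {k a b} → CyclicStep (2 + k) a b → ¬ CyclicStep (2 + k) b a
cyclicStep-asym forward ()
cyclicStep-asym wrap    ()

cyclicStep-from-top : ∀ {k b} → b ℕ.≤ k → CyclicStep k k b → b ≡ 0
cyclicStep-from-top b≤k forward = ⊥-elim (ℕ.n≮n _ b≤k)
cyclicStep-from-top _   wrap    = refl

cyclicStep-from-below : ∀ {k a b} → a ℕ.< k → CyclicStep k a b → b ≡ suc a
cyclicStep-from-below _   forward = refl
cyclicStep-from-below a<k wrap    = ⊥-elim (ℕ.n≮n _ a<k)

csuc≢id : ∀ {k} (i : Fin (3 + k)) → csuc i ≢ i
csuc≢id i eq = cyclicStep-irrefl (subst (CyclicStep _ (toℕ i)) (cong toℕ eq) (csuc-step i))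

csuc²≢id : ∀ {k} (i : Fin (3 + k)) → csuc (csuc i) ≢ i
csuc²≢id i eq = cyclicStep-asym (csuc-step i) (subst (CyclicStep _ _) (cong toℕ eq) (csuc-step (csuc i)))

csuc-surjective : ∀ {k} (j : Fin (suc k)) → ∃ λ i → csuc i ≡ j
csuc-surjective {k} zero = fromℕ k , Fin.toℕ-injective
  (cyclicStep-from-top (ℕ.s≤s⁻¹ (Fin.toℕ<n (csuc (fromℕ k))))
    (subst (λ a → CyclicStep k a (toℕ (csuc (fromℕ k)))) (Fin.toℕ-fromℕ k)
      (csuc-step (fromℕ k))))
csuc-surjective {k} (suc j) = inject₁ j , Fin.toℕ-injective
  (cyclicStep-from-below (Fin.toℕ<n j)
    (subst (λ a → CyclicStep k a (toℕ (csuc (inject₁ j)))) (Fin.toℕ-inject₁ j)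
      (csuc-step (inject₁ j))))

module _ {N : ℕ} {R : Fin N → Fin N → Set} where

  _++ʷ_ : ∀ {a b c} → Walk R a b → Walk R b c → Walk R a c
  here       ++ʷ w′ = w′
  step r w   ++ʷ w′ = step r (w ++ʷ w′)

  reverseʷ : (∀ x y → R x y → R y x) → ∀ {a b} → Walk R a b → Walk R b a
  reverseʷ R-sym w = go w here
    where
    go : ∀ {a b c} → Walk R a b → Walk R a c → Walk R b c
    go here       acc = acc
    go (step r w) acc = go w (step (R-sym _ _ r) acc)

  walk-exits : {P : Fin N → Set} → Decidable P → ∀ {a b} → Walk R a b → P a → ¬ P b →
               ∃₂ λ x y → R x y × P x × ¬ P y
  walk-exits P? here             pa ¬pb = ⊥-elim (¬pb pa)
  walk-exits P? (step {v = v} r w) pa ¬pb with P? v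
  ... | yes pv = walk-exits P? w pv ¬pb
  ... | no ¬pv = _ , _ , r , pa , ¬pv

argmax : ∀ {k} (f : Fin (suc k) → ℕ) → ∃ λ i → ∀ j → f j ℕ.≤ f i
argmax {zero}  f = zero , λ { zero → ℕ.≤-refl }
argmax {suc k} f with argmax (f ∘ suc)
... | i , max with f zero ℕ.≤? f (suc i)
...   | yes le = suc i , λ { zero → le ; (suc j) → max j }
...   | no ¬le = zero , λ { zero → ℕ.≤-refl
                          ; (suc j) → ℕ.≤-trans (max j) (ℕ.<⇒≤ (ℕ.≰⇒> ¬le)) }

module ParentTree {n : ℕ} (G : Graph (suc n)) (parent : (i : Fin n) → ∃ (InPrev G (suc i))) where

  private
    V : Set
    V = Fin (suc n)

  par : Fin n → V
  par i = proj₁ (parent i)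

  par< : ∀ i → par i < suc i
  par< i = proj₁ (proj₂ (parent i))

  data _↦_ : V → V → Set where
    parent-edge : ∀ i → suc i ↦ par i

  isParent : V → V → Bool
  isParent zero    _ = false
  isParent (suc i) p = ⌊ par i ≟ p ⌋

  isParent⇒↦ : ∀ v p → T (isParent v p) → v ↦ p
  isParent⇒↦ (suc i) p t with toWitness t
  ... | refl = parent-edge i

  ↦⇒isParent : ∀ {v p} → v ↦ p → T (isParent v p)
  ↦⇒isParent (parent-edge i) = fromWitness refl

  ↦-unique : ∀ {v p p′} → v ↦ p → v ↦ p′ → p ≡ p′
  ↦-unique (parent-edge i) (parent-edge .i) = refl

  ↦-adj : ∀ {v p} → v ↦ p → Adj G v p
  ↦-adj (parent-edge i) = proj₂ (proj₂ (parent i))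

  ↦-< : ∀ {v p} → v ↦ p → p < v
  ↦-< (parent-edge i) = par< i

  treeAdj : V → V → Bool
  treeAdj u v = isParent u v ∨ isParent v u

  _~_ : V → V → Set
  u ~ v = T (treeAdj u v)

  ~⇒↦ : ∀ u v → u ~ v → u ↦ v ⊎ v ↦ u
  ~⇒↦ u v t = Sum.map (isParent⇒↦ u v) (isParent⇒↦ v u) (Equivalence.to T-∨ t)

  ↦⇒~ : ∀ {u v} → u ↦ v → u ~ v
  ↦⇒~ e = Equivalence.from T-∨ (inj₁ (↦⇒isParent e))

  ↦⇒~ˢ : ∀ {u v} → u ↦ v → v ~ u
  ↦⇒~ˢ e = Equivalence.from T-∨ (inj₂ (↦⇒isParent e))

  ~-sym : ∀ u v → u ~ v → v ~ u
  ~-sym u v t = Sum.[ ↦⇒~ˢ , ↦⇒~ ] (~⇒↦ u v t)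

  ~-adj : ∀ u v → u ~ v → Adj G u v
  ~-adj u v t = Sum.[ ↦-adj , Graph.sym G _ _ ∘ ↦-adj ] (~⇒↦ u v t)

  ~-downward : ∀ {u v} → u ~ v → v < u → u ↦ v
  ~-downward {u} {v} t v<u with ~⇒↦ u v t
  ... | inj₁ e = e
  ... | inj₂ e = ⊥-elim (ℕ.<-asym v<u (↦-< e))

  walk-to-root : ∀ v → Walk _~_ v zero
  walk-to-root = WF.All.wfRec <-wellFounded _ (λ v → Walk _~_ v zero) to-parent
    where
    to-parent : ∀ v → WfRec _<_ (λ v → Walk _~_ v zero) v → Walk _~_ v zero
    to-parent zero    _   = here
    to-parent (suc i) rec = step (↦⇒~ (parent-edge i)) (rec (par< i))

  -- The largest vertex of a cycle would have two distinct smaller neighbours, both its parent.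
  acyclic : ¬ Cycle _~_
  acyclic C = csuc²≢id p (trans (cong csuc pk) (inj C next≡prev))
    where
    top : ∃ λ k → ∀ j → toℕ (vs C j) ℕ.≤ toℕ (vs C k)
    top = argmax (toℕ ∘ vs C)
    k : Fin (3 + m C)
    k = proj₁ top
    p : Fin (3 + m C)
    p = proj₁ (csuc-surjective k)
    pk : csuc p ≡ k
    pk = proj₂ (csuc-surjective k)
    below-top : ∀ j → vs C j ≢ vs C k → vs C j < vs C k
    below-top j ≢k = Fin.≤∧≢⇒< (proj₂ top j) ≢k
    next↦ : vs C k ↦ vs C (csuc k)
    next↦ = ~-downward (adjs C k) (below-top (csuc k) (csuc≢id k ∘ inj C))
    prev↦ : vs C k ↦ vs C p
    prev↦ = ~-downward (subst (λ z → vs C z ~ vs C p) pk (~-sym (vs C p) (vs C (csuc p)) (adjs C p)))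
                        (below-top p (λ eq → csuc≢id p (trans pk (≡.sym (inj C eq)))))
    next≡prev : vs C (csuc k) ≡ vs C p
    next≡prev = ↦-unique next↦ prev↦

  parentTree : SpanningTree G
  parentTree = record
    { tadj = treeAdj
    ; tsym = ~-sym
    ; sub  = ~-adj
    ; conn = λ u v → walk-to-root u ++ʷ reverseʷ ~-sym (walk-to-root v)
    ; acyc = acyclic
    }

module _ {N : ℕ} (G : Graph N) where

  adj⇒≢ : ∀ {x y} → Adj G x y → x ≢ y
  adj⇒≢ {x} xy refl = irrefl G x xy

  triangle : ∀ {u v w} → Adj G u v → Adj G v w → Adj G w u → Cycle (Adj G)
  triangle {u} {v} {w} uv vw wu = record { m = 0 ; vs = corner ; inj = corner-injective ; adjs = side }
    where
    corner : Fin 3 → Fin N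
    corner zero             = u
    corner (suc zero)       = v
    corner (suc (suc zero)) = w

    side : ∀ i → Adj G (corner i) (corner (csuc i))
    side zero             = uv
    side (suc zero)       = vw
    side (suc (suc zero)) = wu

    corner-injective : Injective _≡_ _≡_ corner
    corner-injective {zero}             {zero}             _  = refl
    corner-injective {zero}             {suc zero}         eq = ⊥-elim (adj⇒≢ uv eq)
    corner-injective {zero}             {suc (suc zero)}   eq = ⊥-elim (adj⇒≢ wu (≡.sym eq))
    corner-injective {suc zero}         {zero}             eq = ⊥-elim (adj⇒≢ uv (≡.sym eq))
    corner-injective {suc zero}         {suc zero}         _  = refl
    corner-injective {suc zero}         {suc (suc zero)}   eq = ⊥-elim (adj⇒≢ vw eq)
    corner-injective {suc (suc zero)}   {zero}             eq = ⊥-elim (adj⇒≢ wu eq)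
    corner-injective {suc (suc zero)}   {suc zero}         eq = ⊥-elim (adj⇒≢ vw (≡.sym eq))
    corner-injective {suc (suc zero)}   {suc (suc zero)}   _  = refl

  triangle-has-edge : ∀ {u v w} (uv : Adj G u v) (vw : Adj G v w) (wu : Adj G w u) →
                      HasEdge (triangle uv vw wu) u v
  triangle-has-edge _ _ _ = zero , inj₁ (refl , refl)

  triangle-edges : (P : Fin N → Fin N → Set) → (∀ x y → P x y → P y x) →
                   ∀ {u v w} (uv : Adj G u v) (vw : Adj G v w) (wu : Adj G w u) →
                   P u v → P v w → P w u → ∀ x y → HasEdge (triangle uv vw wu) x y → P x y
  triangle-edges P P-sym _ _ _ puv pvw pwu x y (zero , inj₁ (refl , refl))           = puv
  triangle-edges P P-sym _ _ _ puv pvw pwu x y (zero , inj₂ (refl , refl))           = P-sym _ _ puv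
  triangle-edges P P-sym _ _ _ puv pvw pwu x y (suc zero , inj₁ (refl , refl))       = pvw
  triangle-edges P P-sym _ _ _ puv pvw pwu x y (suc zero , inj₂ (refl , refl))       = P-sym _ _ pvw
  triangle-edges P P-sym _ _ _ puv pvw pwu x y (suc (suc zero) , inj₁ (refl , refl)) = pwu
  triangle-edges P P-sym _ _ _ puv pvw pwu x y (suc (suc zero) , inj₂ (refl , refl)) = P-sym _ _ pwu

  girth-triangle : ∀ {a b} (C : Cycle (Adj G)) → len C ≡ 3 → HasEdge C a b → GirthIs G a b 3
  girth-triangle C len≡3 ab = (C , len≡3 , ab) , λ C′ _ → ℕ.m≤m+n 3 (m C′)

punchIn-fromℕ : ∀ {q} (j : Fin q) → punchIn (fromℕ q) j ≡ inject₁ j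
punchIn-fromℕ zero    = refl
punchIn-fromℕ (suc j) = cong suc (punchIn-fromℕ j)

inject₁-mono-≤ : ∀ {q} {i j : Fin q} → i ≤ j → inject₁ i ≤ inject₁ j
inject₁-mono-≤ {i = i} {j} =
  subst₂ ℕ._≤_ (≡.sym (Fin.toℕ-inject₁ i)) (≡.sym (Fin.toℕ-inject₁ j))

data InjectOrLast : ∀ {q} → Fin (suc q) → Set where
  inject : ∀ {q} (j : Fin q) → InjectOrLast (inject₁ j)
  last   : ∀ {q} → InjectOrLast (fromℕ q)

injectOrLast : ∀ {q} (t : Fin (suc q)) → InjectOrLast t
injectOrLast {zero}  zero    = last
injectOrLast {suc q} zero    = inject zero
injectOrLast {suc q} (suc t) with injectOrLast t
... | inject j = inject (suc j)
... | last     = last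

_∷ʳ_ : ∀ {A : Set} {q} → Vector A q → A → Vector A (suc q)
xs ∷ʳ x = insertAt xs (fromℕ _) x

module _ {A : Set} {q} (xs : Vector A q) (x : A) where

  ∷ʳ-inject₁ : ∀ j → (xs ∷ʳ x) (inject₁ j) ≡ xs j
  ∷ʳ-inject₁ j =
    trans (cong (xs ∷ʳ x) (≡.sym (punchIn-fromℕ j))) (insertAt-punchIn xs (fromℕ _) x j)

  ∷ʳ-last : (xs ∷ʳ x) (fromℕ q) ≡ x
  ∷ʳ-last = insertAt-lookup xs (fromℕ _) x

  ∷ʳ-all : (P : A → Set) → (∀ j → P (xs j)) → P x → ∀ t → P ((xs ∷ʳ x) t)
  ∷ʳ-all P all-xs px t with injectOrLast t
  ... | inject j = subst P (≡.sym (∷ʳ-inject₁ j)) (all-xs j)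
  ... | last     = subst P (≡.sym ∷ʳ-last) px

  ∷ʳ-injective : Injective _≡_ _≡_ xs → (∀ j → xs j ≢ x) → Injective _≡_ _≡_ (xs ∷ʳ x)
  ∷ʳ-injective xs-inj fresh {s} {t} eq with injectOrLast s | injectOrLast t
  ... | inject i | inject j =
    cong inject₁ (xs-inj (trans (≡.sym (∷ʳ-inject₁ i)) (trans eq (∷ʳ-inject₁ j))))
  ... | inject i | last     =
    ⊥-elim (fresh i (trans (≡.sym (∷ʳ-inject₁ i)) (trans eq ∷ʳ-last)))
  ... | last     | inject j =
    ⊥-elim (fresh j (trans (≡.sym (∷ʳ-inject₁ j)) (trans (≡.sym eq) ∷ʳ-last)))
  ... | last     | last     = refl

injective-pairs-bound : ∀ {q N} (e : Vector (Fin N × Fin N) q) →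
                        Injective _≡_ _≡_ e → q ℕ.≤ N * N
injective-pairs-bound e e-inj = Fin.injective⇒≤ {f = λ t → Fin.combine (proj₁ (e t)) (proj₂ (e t))}
  λ eq → e-inj (×-≡,≡→≡ (Fin.combine-injective _ _ _ _ eq))

module TriangleClosure {N : ℕ} (G : Graph N) (Tr : SpanningTree G) where

  private
    V : Set
    V = Fin N

    Pair : Set
    Pair = V × V

  _≟ᵖ_ : (a b : Pair) → Dec (a ≡ b)
  _≟ᵖ_ = ≡-dec _≟_ _≟_

  Listed : ∀ {q} → Vector Pair q → V → V → Set
  Listed e u v = ∃ λ j → e j ≡ (u , v)

  ListedEither : ∀ {q} → Vector Pair q → Fin q → V → V → Set
  ListedEither e j x y = e j ≡ (x , y) ⊎ e j ≡ (y , x)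

  Usable : ∀ {q} → Vector Pair q → V → V → Set
  Usable e x y = TAdj Tr x y ⊎ ∃ λ j → ListedEither e j x y

  UsableBy : ∀ {q} → Vector Pair q → Fin q → V → V → Set
  UsableBy e t x y = TAdj Tr x y ⊎ ∃ λ j → j ≤ t × ListedEither e j x y

  usable? : ∀ {q} (e : Vector Pair q) x y → Dec (Usable e x y)
  usable? e x y = T? (tadj Tr x y) ⊎-dec Fin.any? λ j → (e j ≟ᵖ (x , y)) ⊎-dec (e j ≟ᵖ (y , x))

  usable-sym : ∀ {q} (e : Vector Pair q) x y → Usable e x y → Usable e y x
  usable-sym e x y = Sum.map (tsym Tr x y) (λ (j , l) → j , Sum.swap l)

  usableBy-sym : ∀ {q} (e : Vector Pair q) t x y → UsableBy e t x y → UsableBy e t y x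
  usableBy-sym e t x y = Sum.map (tsym Tr x y) (λ (j , j≤t , l) → j , j≤t , Sum.swap l)

  ClosesTriangle : V → V → (V → V → Set) → Set
  ClosesTriangle u v Avail = ∃ λ w → Adj G u w × Adj G v w × Avail u w × Avail v w

  closes-mono : ∀ {u v} {A B : V → V → Set} → (∀ x y → A x y → B x y) →
                ClosesTriangle u v A → ClosesTriangle u v B
  closes-mono A⇒B (w , uw , vw , auw , avw) = w , uw , vw , A⇒B _ _ auw , A⇒B _ _ avw

  module _ {q} (e : Vector Pair q) (p : Pair) where

    listedEither-∷ʳ : ∀ {j x y} → ListedEither e j x y → ListedEither (e ∷ʳ p) (inject₁ j) x y
    listedEither-∷ʳ {j} = Sum.map (trans (∷ʳ-inject₁ e p j)) (trans (∷ʳ-inject₁ e p j))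

    usableBy-∷ʳ : ∀ t x y → UsableBy e t x y → UsableBy (e ∷ʳ p) (inject₁ t) x y
    usableBy-∷ʳ t x y =
      Sum.map₂ λ (j , j≤t , l) → inject₁ j , inject₁-mono-≤ j≤t , listedEither-∷ʳ l

    usable-∷ʳ : ∀ x y → Usable e x y → UsableBy (e ∷ʳ p) (fromℕ q) x y
    usable-∷ʳ x y =
      Sum.map₂ λ (j , l) → inject₁ j , Fin.≤fromℕ (inject₁ j) , listedEither-∷ʳ l

  record TriangleSequence : Set where
    field
      q         : ℕ
      edges     : Vector Pair q
      ordered   : ∀ t → proj₁ (edges t) < proj₂ (edges t)
      adjacent  : ∀ t → Adj G (proj₁ (edges t)) (proj₂ (edges t))
      nonTree   : ∀ t → ¬ TAdj Tr (proj₁ (edges t)) (proj₂ (edges t))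
      injective : Injective _≡_ _≡_ edges
      closes    : ∀ t → ClosesTriangle (proj₁ (edges t)) (proj₂ (edges t)) (UsableBy edges t)

  open TriangleSequence public

  empty : TriangleSequence
  empty = record { q = 0 ; edges = λ () ; ordered = λ () ; adjacent = λ () ; nonTree = λ ()
                 ; injective = λ {} ; closes = λ () }

  Extension : TriangleSequence → V → V → Set
  Extension S u v = u < v × Adj G u v × ¬ TAdj Tr u v × ¬ Listed (edges S) u v
                    × ClosesTriangle u v (Usable (edges S))

  extension? : ∀ S u v → Dec (Extension S u v)
  extension? S u v =
    (u Fin.<? v) ×-dec T? (adj G u v) ×-dec ¬? (T? (tadj Tr u v))
    ×-dec ¬? (Fin.any? λ j → edges S j ≟ᵖ (u , v))
    ×-dec Fin.any? λ w → T? (adj G u w) ×-dec T? (adj G v w)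
                         ×-dec usable? (edges S) u w ×-dec usable? (edges S) v w

  extend : ∀ S {u v} → Extension S u v → TriangleSequence
  extend S {u} {v} (u<v , uv , ¬tree , ¬listed , closes-uv) = record
    { q         = suc (q S)
    ; edges     = e′
    ; ordered   = ∷ʳ-all (edges S) (u , v) (λ (x , y) → x < y) (ordered S) u<v
    ; adjacent  = ∷ʳ-all (edges S) (u , v) (λ (x , y) → Adj G x y) (adjacent S) uv
    ; nonTree   = ∷ʳ-all (edges S) (u , v) (λ (x , y) → ¬ TAdj Tr x y) (nonTree S) ¬tree
    ; injective = ∷ʳ-injective (edges S) (u , v) (injective S) (λ j eq → ¬listed (j , eq))
    ; closes    = closes′
    }
    where
    e′ : Vector Pair (suc (q S))
    e′ = edges S ∷ʳ (u , v)

    closes′ : ∀ t → ClosesTriangle (proj₁ (e′ t)) (proj₂ (e′ t)) (UsableBy e′ t)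
    closes′ t with injectOrLast t
    ... | inject j = subst (λ (x , y) → ClosesTriangle x y (UsableBy e′ (inject₁ j)))
                           (≡.sym (∷ʳ-inject₁ (edges S) (u , v) j))
                           (closes-mono (usableBy-∷ʳ (edges S) (u , v) j) (closes S j))
    ... | last     = subst (λ (x , y) → ClosesTriangle x y (UsableBy e′ (fromℕ (q S))))
                           (≡.sym (∷ʳ-last (edges S) (u , v)))
                           (closes-mono (usable-∷ʳ (edges S) (u , v)) closes-uv)

  Saturated : TriangleSequence → Set
  Saturated S = ∀ u v → ¬ Extension S u v

  saturate : ∀ k S → N * N ℕ.≤ k + q S → Σ TriangleSequence Saturated
  saturate k S bound with Fin.any? (λ u → Fin.any? (extension? S u))
  saturate k       S bound | no none = S , λ u v ext → none (u , v , ext)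
  saturate zero    S bound | yes (_ , _ , ext) =
    ⊥-elim (ℕ.n≮n (q S) (ℕ.≤-trans (injective-pairs-bound _ (injective (extend S ext))) bound))
  saturate (suc k) S bound | yes (_ , _ , ext) =
    saturate k (extend S ext) (subst (N * N ℕ.≤_) (≡.sym (ℕ.+-suc k (q S))) bound)

  saturated-sequence : Σ TriangleSequence Saturated
  saturated-sequence = saturate (N * N) empty (ℕ.m≤m+n (N * N) 0)

  triangle-through : ∀ S t → Σ (Cycle (Adj G)) λ C → len C ≡ 3
                       × HasEdge C (proj₁ (edges S t)) (proj₂ (edges S t))
                       × (∀ x y → HasEdge C x y → UsableBy (edges S) t x y)
  triangle-through S t with closes S t
  ... | w , uw , vw , usable-uw , usable-vw =
    triangle G uv vw wu , refl , triangle-has-edge G uv vw wu ,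
    triangle-edges G (UsableBy (edges S) t) (usableBy-sym (edges S) t) uv vw wu
      (inj₂ (t , Fin.≤-refl , inj₁ refl)) usable-vw
      (usableBy-sym (edges S) t _ _ usable-uw)
    where
    uv : Adj G (proj₁ (edges S t)) (proj₂ (edges S t))
    uv = adjacent S t
    wu : Adj G w (proj₁ (edges S t))
    wu = Graph.sym G _ _ uw

module GoodOrderClosure {n : ℕ} (G : Graph (suc n)) (good : GoodOrder G) where

  open ParentTree G (proj₁ ∘ good)
  open TriangleClosure G parentTree

  private
    V : Set
    V = Fin (suc n)

  module _ (S : TriangleSequence) (saturated : Saturated S) where

    Complete : V → Set
    Complete v = ∀ u → u < v → Adj G u v → ¬ u ~ v → Listed (edges S) u v

    usable-below : ∀ {v} → WfRec _<_ Complete v →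
                   ∀ {x y} → x < v → y < v → Adj G x y → Usable (edges S) x y
    usable-below rec {x} {y} x<v y<v xy with T? (treeAdj x y)
    ... | yes tree = inj₁ tree
    ... | no ¬tree with Fin.<-cmp x y
    ...   | tri< x<y _ _ = inj₂ (map₂ inj₁ (rec y<v x x<y xy ¬tree))
    ...   | tri≈ _ refl _ = ⊥-elim (irrefl G x xy)
    ...   | tri> _ _ y<x = inj₂ (map₂ inj₂
                              (rec x<v y y<x (Graph.sym G x y xy) (¬tree ∘ ~-sym y x)))

    complete-step : ∀ v → WfRec _<_ Complete v → Complete v
    complete-step zero    _   u () _ _
    complete-step (suc i) rec u u<v uv ¬tree with Fin.any? (λ j → edges S j ≟ᵖ (u , suc i))
    ... | yes listed = listed
    ... | no ¬listed = ⊥-elim (saturated _ _ (proj₂ extension))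
      where
      walk-in-Sᵢ : Walk (λ x y → Adj G x y × InPrev G (suc i) x × InPrev G (suc i) y) (par i) u
      walk-in-Sᵢ = proj₂ (good i) (par i) u (proj₂ (proj₁ (good i))) (u<v , Graph.sym G _ _ uv)

      ¬usable-u : ¬ Usable (edges S) u (suc i)
      ¬usable-u (inj₁ tree)          = ¬tree tree
      ¬usable-u (inj₂ (j , inj₁ eq)) = ¬listed (j , eq)
      ¬usable-u (inj₂ (j , inj₂ eq)) = ℕ.<-asym u<v (subst (λ (a , b) → a < b) eq (ordered S j))

      -- On a walk in S_i from the parent of suc i to u, the first vertex y not joined to suc i
      -- by a usable edge closes a triangle with its predecessor x, so it extends S.
      extension : ∃ λ y → Extension S y (suc i)
      extension with walk-exits (λ x → usable? (edges S) x (suc i)) walk-in-Sᵢ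
                                (inj₁ (↦⇒~ˢ (parent-edge i))) ¬usable-u
      ... | x , y , (xy , (x<v , vx) , (y<v , vy)) , usable-x , ¬usable-y =
        y , y<v , Graph.sym G _ _ vy , ¬usable-y ∘ inj₁ ,
        (λ (j , eq) → ¬usable-y (inj₂ (j , inj₁ eq))) ,
        x , yx , vx , usable-below rec y<v x<v yx , usable-sym (edges S) x (suc i) usable-x
        where
        yx : Adj G y x
        yx = Graph.sym G _ _ xy

    complete : ∀ v → Complete v
    complete = WF.All.wfRec <-wellFounded _ Complete complete-step

corollary1p1 : (n : ℕ) (G : Graph (suc n)) → GoodOrder G → DPGood G
corollary1p1 n G good =
  parentTree , q S , edges S , (λ _ → 3) ,
  ordered S , adjacent S , nonTree S , injective S ,
  (λ u v u<v uv ¬tree → complete S saturated v u u<v uv ¬tree) ,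
  (λ t → let (C , len≡3 , has-uv , _) = triangle-through S t in girth-triangle G C len≡3 has-uv) ,
  (λ _ _ _ → ℕ.≤-refl) ,
  (λ _ → 1 , refl) ,
  triangle-through S
  where
  open ParentTree G (proj₁ ∘ good)
  open TriangleClosure G parentTree
  open GoodOrderClosure G good
  S : TriangleSequence
  S = proj₁ saturated-sequence
  saturated : Saturated S
  saturated = proj₂ saturated-sequence
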